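{- Let $\mathcal{M}$ be an $n$-maniplex, let $\mathcal{C}$ be an $\ell$-colouring of the facets of $\mathcal{M}$, and let $\omega$ be a $k$-weight function for $\mathcal{M}$. If $\mathcal{M}^\omega$ is connected, then $(2^{(\mathcal{M},\mathcal{C})})^{\omega_\mathcal{C}}$ is connected.
   Context: An $n$-maniplex is a connected $n$-valent simple graph with a proper edge-colouring by $\{0,\dots,n-1\}$ such that whenever $|i-j|>1$ the edges of colours $i,j$ form a disjoint union of $4$-cycles. Vertices are flags; $u^i$ is the $i$-neighbour of $u$. Facets are the connected components after deleting the edges of colour $n-1$. An $\ell$-colouring is a surjection $\mathcal{C}$ from facets to $\{1,\dots,\ell\}$; a flag's colour is its facet's colour. A $k$-weight function is a map $\omega\colon E(\mathcal{M})\to\mathbb{Z}_k$. The colour-coded extension $2^{(\mathcal{M},\mathcal{C})}$ is the $(n+1)$-maniplex with flag set $\mathcal{F}\times\mathbb{Z}_2^\ell$ ($\mathcal{F}$ the flags of $\mathcal{M}$), with $(u,x)^i=(u^i,x)$ for $i<n$ and $(u,x)^n=(u,x^j)$ where $j$ is the colour of $u$ and $x^j$ differs from $x$ only in coordinate $j$. The parity $\sigma(x)$ is $(-1)^b$ with $b$ the number of coordinates of $x$ equal to $1$. The extended weight $\omega_\mathcal{C}$ assigns to the $i$-edge joining $(u,x)$ and $(u^i,x)$ ($i<n$) the value $\sigma(x)\omega(uu^i)$, and $0$ to every $n$-edge. For a graph $\Gamma$ with weight $\omega\colon E(\Gamma)\to\mathbb{Z}_k$, the cross-cover $\Gamma^\omega$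 has vertex set $V(\Gamma)\times\mathbb{Z}_k$ with $(u,i)$ adjacent to $(v,\omega(e)-i)$ for each edge $e=uv$ and $i\in\mathbb{Z}_k$. -}

module Defs where

open import Data.Nat using (ℕ; zero; suc; _+_; _∸_; _<_; NonZero)
open import Data.Nat.DivMod using (_%_; m%n<n)
open import Data.Fin using (Fin; toℕ; fromℕ<)
open import Data.Bool using (Bool; true; false; not; if_then_else_)
open import Data.Vec using (Vec; []; _∷_; updateAt)
open import Data.Product using (Σ; _×_; _,_; ∃)
open import Data.Sum using (_⊎_)
open import Data.Maybe using (Maybe; just; nothing)
import Data.Maybe as Maybe
open import Relation.Binary.PropositionalEquality using (_≡_; _≢_)
open import Relation.Binary.Construct.Closure.ReflexiveTransitive using (Star)

module Zmod (k : ℕ) .{{_ : NonZero k}} where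
  Zk : Set
  Zk = Fin k

  mk : ℕ → Zk
  mk m = fromℕ< (m%n<n m k)

  0z : Zk
  0z = mk 0

  neg : Zk → Zk
  neg a = mk (k ∸ toℕ a)

  _⊖_ : Zk → Zk → Zk
  w ⊖ a = mk (toℕ w + (k ∸ toℕ a))

Connected : {V : Set} → (V → V → Set) → Set
Connected {V} Adj = (u v : V) → Star Adj u v

-- Flags form a type; u^i = r i u.
-- r i is an involution without fixed points (proper n-valent colouring,
-- no loops); distinct colours give distinct neighbours (simple graph);
-- for |i-j|>1 the i,j-edges form 4-cycles: (r i r j)^2 = id.

FarApart : {n : ℕ} → Fin n → Fin n → Set
FarApart i j = (suc (toℕ i) < toℕ j) ⊎ (suc (toℕ j) < toℕ i)

record Maniplex (n : ℕ) : Set₁ where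
  field
    Flag     : Set
    r        : Fin n → Flag → Flag
    r-invol  : ∀ i u → r i (r i u) ≡ u
    r-nofix  : ∀ i u → r i u ≢ u
    r-simple : ∀ i j u → r i u ≡ r j u → i ≡ j
    r-square : ∀ i j u → FarApart i j → r i (r j (r i (r j u))) ≡ u

  Adj : Flag → Flag → Set
  Adj u v = ∃ λ i → r i u ≡ v

  field
    connected : Connected Adj

open Maniplex public

-- A function on facets (components after
-- deleting (n-1)-edges) is the same as a function on flags that is
-- invariant along i-edges for i < n-1.  Colours {1..ℓ} ↦ Fin ℓ.

record Colouring {n : ℕ} (M : Maniplex n) (ℓ : ℕ) : Set where
  field
    col        : Flag M → Fin ℓ
    col-facet  : ∀ (i : Fin n) u → suc (toℕ i) < n → col (r M i u) ≡ col u
    col-onto   : ∀ (j : Fin ℓ) → ∃ λ u → col u ≡ j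

open Colouring public

record Weight {n : ℕ} (M : Maniplex n) (k : ℕ) : Set where
  field
    wt     : Fin n → Flag M → Fin k
    wt-sym : ∀ i u → wt i (r M i u) ≡ wt i u

open Weight public

-- Cross-cover of an edge-coloured graph given by neighbour maps
-- r : I → V → V and an edge weight w i u (weight of the i-edge at u):
-- vertex set V × ℤ_k, (u,a) adjacent to (r i u, w i u - a).

module _ (k : ℕ) .{{_ : NonZero k}} where
  open Zmod k

  CrossAdj : {I V : Set} → (I → V → V) → (I → V → Zk) → V × Zk → V × Zk → Set
  CrossAdj {I} r w (u , a) (v , b) = Σ I λ i → (r i u ≡ v) × (b ≡ (w i u ⊖ a))

  CrossCoverConnected : {I V : Set} → (I → V → V) → (I → V → Zk) → Set
  CrossCoverConnected r w = Connected (CrossAdj r w)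

-- Colours of the extension: Fin (suc n); `inner i` is just j when i is
-- the colour j < n, and nothing when i = n.

inner : {n : ℕ} → Fin (suc n) → Maybe (Fin n)
inner {zero}  Fin.zero    = nothing
inner {suc n} Fin.zero    = just Fin.zero
inner {suc n} (Fin.suc i) = Maybe.map Fin.suc (inner i)

ones : {ℓ : ℕ} → Vec Bool ℓ → ℕ
ones []           = 0
ones (true ∷ x)  = suc (ones x)
ones (false ∷ x) = ones x

flipAt : {ℓ : ℕ} → Vec Bool ℓ → Fin ℓ → Vec Bool ℓ
flipAt x j = updateAt x j not

module _ {n ℓ : ℕ} (M : Maniplex n) (C : Colouring M ℓ) where

  ExtFlag : Set
  ExtFlag = Flag M × Vec Bool ℓ

  extR : Fin (suc n) → ExtFlag → ExtFlag
  extR i (u , x) with inner i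
  ... | just j  = (r M j u , x)
  ... | nothing = (u , flipAt x (col C u))

  module _ (k : ℕ) .{{_ : NonZero k}} (ω : Weight M k) where
    open Zmod k

    signed : Vec Bool ℓ → Zk → Zk
    signed x a with ones x % 2
    ... | zero  = a
    ... | suc _ = neg a

    extW : Fin (suc n) → ExtFlag → Zk
    extW i (u , x) with inner i
    ... | just j  = signed x (wt ω j u)
    ... | nothing = 0z

{-# OPTIONS --safe #-}
module Submission where

-- The cross-cover of 2^(M,C) is made of layers x ∈ ℤ₂^ℓ joined by the n-edges. Inside layer x
-- the i-edges (i < n) form a copy of the cross-cover of M with weights σ(x)ω, so along M-walks a
-- vertex can move to any flag of its layer, in particular into a facet of colour j, whose n-edge
-- (of weight 0) flips x_j. Flipping the coordinates equal to 1 one by one reaches the layer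
-- x = 0, where σ = 1 and the layer is a copy of M^ω, connected by hypothesis. Cross-adjacency
-- is symmetric, since the neighbour maps are involutions and the weights are edge weights, so
-- these walks can also be reversed.

open import Defs
open import Data.Nat using (ℕ; NonZero; zero; suc; _+_; _*_; _∸_; pred)
open import Data.Nat.Properties using (+-assoc; +-∸-assoc; m+n∸m≡n; m∸n+n≡m; <⇒≤)
open import Data.Nat.DivMod using (_%_; _/_; m%n<n; m≡m%n+[m/n]*n; %-remove-+ˡ; m<n⇒m%n≡m)
open import Data.Nat.Divisibility using (n∣m*n)
open import Data.Fin using (Fin; toℕ; inject₁; fromℕ)
open import Data.Fin.Properties using (toℕ-injective; toℕ-fromℕ<; toℕ<n)
open import Data.Bool using (Bool; true; false)
open import Data.Bool.Properties using (not-involutive)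
open import Data.Vec using (Vec; []; _∷_; replicate)
open import Data.Vec.Properties using (updateAt-updateAt; updateAt-id-local)
open import Data.Product using (_×_; _,_; ∃; ∃-syntax; proj₁; proj₂; map; map₂)
open import Data.Maybe using (just; nothing)
open import Function using (id; _∘_)
open import Relation.Binary.Core using (_⇒_; _=[_]⇒_)
open import Relation.Binary.Definitions using (Symmetric)
open import Relation.Binary.PropositionalEquality
open import Relation.Binary.Construct.Closure.ReflexiveTransitive using (Star; ε; _◅_; _◅◅_; gmap; reverse)

module ZmodProperties (k : ℕ) .{{_ : NonZero k}} where
  open Zmod k

  toℕ-mk : ∀ m → toℕ (mk m) ≡ m % k
  toℕ-mk m = toℕ-fromℕ< (m%n<n m k)

  ⊖-involutive : ∀ w a → w ⊖ (w ⊖ a) ≡ a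
  ⊖-involutive w a = toℕ-injective (begin
      toℕ (w ⊖ (w ⊖ a))  ≡⟨ toℕ-mk (W + (k ∸ S)) ⟩
      (W + (k ∸ S)) % k  ≡⟨ cong (_% k) W+[k∸S]≡q*k+A ⟩
      (q * k + A) % k    ≡⟨ %-remove-+ˡ A (n∣m*n q) ⟩
      A % k              ≡⟨ m<n⇒m%n≡m (toℕ<n a) ⟩
      A                  ∎)
    where
    open ≡-Reasoning
    W A S q : ℕ
    W = toℕ w
    A = toℕ a
    S = toℕ (w ⊖ a)
    q = (W + (k ∸ A)) / k

    W+k≡S+[q*k+A] : W + k ≡ S + (q * k + A)
    W+k≡S+[q*k+A] = begin
      W + k                          ≡⟨ cong (W +_) (sym (m∸n+n≡m (<⇒≤ (toℕ<n a)))) ⟩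
      W + (k ∸ A + A)                ≡⟨ sym (+-assoc W (k ∸ A) A) ⟩
      W + (k ∸ A) + A                ≡⟨ cong (_+ A) (m≡m%n+[m/n]*n (W + (k ∸ A)) k) ⟩
      (W + (k ∸ A)) % k + q * k + A  ≡⟨ cong (λ s → s + q * k + A) (sym (toℕ-mk (W + (k ∸ A)))) ⟩
      S + q * k + A                  ≡⟨ +-assoc S (q * k) A ⟩
      S + (q * k + A)                ∎

    W+[k∸S]≡q*k+A : W + (k ∸ S) ≡ q * k + A
    W+[k∸S]≡q*k+A = begin
      W + (k ∸ S)          ≡⟨ sym (+-∸-assoc W (<⇒≤ (toℕ<n (w ⊖ a)))) ⟩
      W + k ∸ S            ≡⟨ cong (_∸ S) W+k≡S+[q*k+A] ⟩
      S + (q * k + A) ∸ S  ≡⟨ m+n∸m≡n S (q * k + A) ⟩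
      q * k + A            ∎

module CrossCover (k : ℕ) .{{_ : NonZero k}} {I V : Set} (r : I → V → V) where
  open Zmod k
  open ZmodProperties k

  CrossAdj-cong : {w w′ : I → V → Zk} → (∀ i u → w i u ≡ w′ i u) → CrossAdj k r w ⇒ CrossAdj k r w′
  CrossAdj-cong w≗w′ {u , a} (i , u→v , b≡) = i , u→v , trans b≡ (cong (_⊖ a) (w≗w′ i u))

  CrossAdj-sym : {w : I → V → Zk} → (∀ i u → r i (r i u) ≡ u) → (∀ i u → w i (r i u) ≡ w i u) →
                 Symmetric (CrossAdj k r w)
  CrossAdj-sym {w} r-invol w-sym {u , a} (i , refl , refl) = i , r-invol i u , (begin
      a                           ≡⟨ sym (⊖-involutive (w i u) a) ⟩
      w i u ⊖ (w i u ⊖ a)         ≡⟨ cong (_⊖ (w i u ⊖ a)) (sym (w-sym i u)) ⟩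
      w i (r i u) ⊖ (w i u ⊖ a)   ∎)
    where open ≡-Reasoning

  lift-walk : (w : I → V → Zk) {u v : V} → Star (λ u v → ∃ λ i → r i u ≡ v) u v →
              ∀ a → ∃[ b ] Star (CrossAdj k r w) (u , a) (v , b)
  lift-walk w ε a = a , ε
  lift-walk w {u} ((i , refl) ◅ walk) a = map₂ ((i , refl , refl) ◅_) (lift-walk w walk (w i u ⊖ a))

flipAt-involutive : ∀ {ℓ} (x : Vec Bool ℓ) j → flipAt (flipAt x j) j ≡ x
flipAt-involutive x j = trans (updateAt-updateAt j x) (updateAt-id-local j x (not-involutive _))

ones-replicate-false : ∀ ℓ → ones (replicate ℓ false) ≡ 0
ones-replicate-false zero = refl
ones-replicate-false (suc ℓ) = ones-replicate-false ℓ

ones≡0⇒replicate-false : ∀ {ℓ} (x : Vec Bool ℓ) → ones x ≡ 0 → x ≡ replicate ℓ false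
ones≡0⇒replicate-false [] _ = refl
ones≡0⇒replicate-false (false ∷ x) ones≡0 = cong (false ∷_) (ones≡0⇒replicate-false x ones≡0)

ones≡suc⇒flipAt-ones : ∀ {ℓ m} (x : Vec Bool ℓ) → ones x ≡ suc m → ∃[ j ] ones (flipAt x j) ≡ m
ones≡suc⇒flipAt-ones (true ∷ x) ones≡1+m = Fin.zero , cong pred ones≡1+m
ones≡suc⇒flipAt-ones (false ∷ x) ones≡1+m = map Fin.suc id (ones≡suc⇒flipAt-ones x ones≡1+m)

inner-inject₁ : ∀ {n} (i : Fin n) → inner (inject₁ i) ≡ just i
inner-inject₁ Fin.zero = refl
inner-inject₁ (Fin.suc i) rewrite inner-inject₁ i = refl

inner-fromℕ : ∀ n → inner (fromℕ n) ≡ nothing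
inner-fromℕ zero = refl
inner-fromℕ (suc n) rewrite inner-fromℕ n = refl

module Extension {n ℓ : ℕ} (M : Maniplex n) (C : Colouring M ℓ) (k : ℕ) .{{_ : NonZero k}} (ω : Weight M k) where
  open Zmod k
  open CrossCover k

  ExtAdj : ExtFlag M C × Zk → ExtFlag M C × Zk → Set
  ExtAdj = CrossAdj k (extR M C) (extW M C k ω)

  zeros : Vec Bool ℓ
  zeros = replicate ℓ false

  inLayer : Vec Bool ℓ → Flag M × Zk → ExtFlag M C × Zk
  inLayer x (u , a) = (u , x) , a

  layerWt : Vec Bool ℓ → Fin n → Flag M → Zk
  layerWt x i u = signed M C k ω x (wt ω i u)

  signed-zeros : ∀ a → signed M C k ω zeros a ≡ a
  signed-zeros a with ones zeros % 2 | cong (_% 2) (ones-replicate-false ℓ)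
  ... | zero | _ = refl

  extR-involutive : ∀ i P → extR M C i (extR M C i P) ≡ P
  extR-involutive i (u , x) with inner i
  ... | just j  = cong (_, x) (r-invol M j u)
  ... | nothing = cong (u ,_) (flipAt-involutive x (col C u))

  extW-sym : ∀ i P → extW M C k ω i (extR M C i P) ≡ extW M C k ω i P
  extW-sym i (u , x) with inner i
  ... | just j  = cong (signed M C k ω x) (wt-sym ω j u)
  ... | nothing = refl

  extR-inject₁ : ∀ i u x → extR M C (inject₁ i) (u , x) ≡ (r M i u , x)
  extR-inject₁ i u x rewrite inner-inject₁ i = refl

  extW-inject₁ : ∀ i u x → extW M C k ω (inject₁ i) (u , x) ≡ layerWt x i u
  extW-inject₁ i u x rewrite inner-inject₁ i = refl

  extR-fromℕ : ∀ u x → extR M C (fromℕ n) (u , x) ≡ (u , flipAt x (col C u))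
  extR-fromℕ u x rewrite inner-fromℕ n = refl

  extW-fromℕ : ∀ u x → extW M C k ω (fromℕ n) (u , x) ≡ 0z
  extW-fromℕ u x rewrite inner-fromℕ n = refl

  ExtAdj-sym : Symmetric ExtAdj
  ExtAdj-sym = CrossAdj-sym (extR M C) extR-involutive extW-sym

  layer-edge : ∀ x → CrossAdj k (r M) (layerWt x) =[ inLayer x ]⇒ ExtAdj
  layer-edge x {u , a} (i , refl , refl) =
    inject₁ i , extR-inject₁ i u x , cong (_⊖ a) (sym (extW-inject₁ i u x))

  colour-edge : ∀ u x a → ExtAdj ((u , x) , a) ((u , flipAt x (col C u)) , 0z ⊖ a)
  colour-edge u x a = fromℕ n , extR-fromℕ u x , cong (_⊖ a) (sym (extW-fromℕ u x))

  layer-walk : ∀ x {u v} → Star (Adj M) u v → ∀ a → ∃[ b ] Star ExtAdj ((u , x) , a) ((v , x) , b)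
  layer-walk x walk a =
    map₂ (gmap (inLayer x) (λ {P Q} → layer-edge x {P} {Q})) (lift-walk (r M) (layerWt x) walk a)

  base-layer-walk : CrossCoverConnected k (r M) (wt ω) → ∀ P Q → Star ExtAdj (inLayer zeros P) (inLayer zeros Q)
  base-layer-walk base-connected P Q =
    gmap (inLayer zeros) (λ {P Q} → layer-edge zeros {P} {Q} ∘ CrossAdj-cong (r M) signed-zeros-wt {P} {Q})
         (base-connected P Q)
    where
    signed-zeros-wt : ∀ i u → wt ω i u ≡ layerWt zeros i u
    signed-zeros-wt i u = sym (signed-zeros (wt ω i u))

  descend : ∀ m x → ones x ≡ m → ∀ u a → ∃[ Q ] Star ExtAdj ((u , x) , a) (inLayer zeros Q)
  descend zero x ones≡0 u a rewrite ones≡0⇒replicate-false x ones≡0 = (u , a) , ε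
  descend (suc m) x ones≡1+m u a with ones≡suc⇒flipAt-ones x ones≡1+m
  ... | j , ones-flipped with col-onto C j
  ... | w , refl with layer-walk x (connected M u w) a
  ... | c , u⇝w = map₂ (λ w⇝base → u⇝w ◅◅ colour-edge w x c ◅ w⇝base)
                       (descend m (flipAt x (col C w)) ones-flipped w (0z ⊖ c))

  descend-to-base : ∀ P → ∃[ Q ] Star ExtAdj P (inLayer zeros Q)
  descend-to-base ((u , x) , a) = descend (ones x) x refl u a

lemma5p4 : (n ℓ k : ℕ) .{{_ : NonZero k}} (M : Maniplex n) (C : Colouring M ℓ) (ω : Weight M k)
    → CrossCoverConnected k (r M) (wt ω)
    → CrossCoverConnected k (extR M C) (extW M C k ω)
lemma5p4 n ℓ k M C ω base-connected P Q =
  proj₂ (descend-to-base P)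
    ◅◅ base-layer-walk base-connected (proj₁ (descend-to-base P)) (proj₁ (descend-to-base Q))
    ◅◅ reverse ExtAdj-sym (proj₂ (descend-to-base Q))
  where open Extension M C k ω
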